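{- In the setting below, if $\gamma$ is a proper generalizer, then $\mathrm{GCG}_{\simeq}(\Phi,\psi,\overset{\simeq}{\gamma})$ maintains Properties 1 and 2, and maintains Property 3 (for the generalizer $\overset{\simeq}{\gamma}$) as an invariant.
   Context: LTS setting. A labeled transition system (LTS) is $\langle\Sigma,Q,Q_0,\Delta\rangle$ (finite labels $\Sigma$, finite states $Q$, initial states $Q_0\subseteq Q$, $\Delta\subseteq Q\times\Sigma\times Q$). Fix an LTS $M_0=\langle\Sigma,Q,Q_0,\Delta_0\rangle$; a completion of $M_0$ is an LTS with the same $\Sigma,Q,Q_0$ and transition relation $\Delta\supseteq\Delta_0$. Let $V=\{x_{p,a,q}: p,q\in Q, a\in\Sigma\}$; an assignment $\sigma:V\to\{0,1\}$ encodes the LTS $M_\sigma$ with $\Sigma,Q,Q_0$ and $\Delta_\sigma=\{(p,a,q):\sigma(x_{p,a,q})=1\}$. $\Phi$ is a propositional formula over $V$ that implies $\bigwedge_{(p,a,q)\in\Delta_0}x_{p,a,q}$. Let $A$ be the set of non-initial states of $M_0$ with no incoming or outgoing transitions in $\Delta_0$. For assignments $\sigma,\rho$ satisfying $\Phi$, $\sigma\simeq\rho$ means there is a bijection $f:Q\to Q$ with $f(q)=q$ for $q\notin A$ such that $(p,a,q)\in\Delta_\sigma$ iff $(f(p),a,f(q))\in\Delta_\rho$. For $\rho\models\Phi$, $[\rho]=\{\sigma:\sigma\models\Phi,\ \sigma\simeq\rho\}$, also viewed as the formula satisfied exactly by its elements. $\psi$ is a specification with satisfaction relation $M\models\psi$,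 assumed invariant under isomorphism: if $\sigma\simeq\rho$ then $M_\sigma\models\psi$ iff $M_\rho\models\psi$. A generalizer maps assignments to formulas over $V$; $\gamma$ is proper if for every $\sigma\models\Phi$ with $M_\sigma\not\models\psi$: $\sigma\models\gamma(\sigma)$, and no $\rho$ with $\rho\models\Phi$, $M_\rho\models\psi$ satisfies $\gamma(\sigma)$. The equivalence closure of $\gamma$ is $\overset{\simeq}{\gamma}(\rho):=\bigvee_{\sigma\in[\rho]}\gamma(\sigma)$. Algorithm $\mathrm{GCG}_{\simeq}(\Phi,\psi,g)$ for a generalizer $g$: keep $\Phi_{cur}:=\Phi$; while $\Phi_{cur}$ is satisfiable, pick an arbitrary $\sigma\models\Phi_{cur}$ (a candidate); if $M_\sigma\models\psi$, output $\sigma$ (a solution) and set $\Phi_{cur}:=\Phi_{cur}\wedge\neg[\sigma]$; else set $\Phi_{cur}:=\Phi_{cur}\wedge\neg g(\sigma)$. In an execution, $\mathsf{Cand}$ and $\mathsf{Sol}$ are the sets of candidates and solutions, and at any point $\mathsf{Pruned}$ is the set of all assignments satisfying some formula $\varphi$ for which a step $\Phi_{cur}:=\Phi_{cur}\wedge\neg\varphi$ has been performed so far. Property 1: for every terminated execution and every $\sigma\models\Phi$, $[\sigma]\cap\mathsf{Sol}$ has at most one element. Property 2: for every terminated execution and every $\sigma\models\Phi$, $[\sigma]\cap\mathsf{Cand}$ has at most one element. Property 3 (invariant, for generalizer $g$): in every execution, at every point, for every $\sigma$ for which the step $\Phi_{cur}:=\Phi_{cur}\wedge\neg g(\sigma)$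 has been performed so far and every $\rho\simeq\sigma$, every assignment satisfying $g(\rho)$ belongs to $\mathsf{Pruned}$. -}

module Defs where

open import Data.Nat using (ℕ)
open import Data.Fin using (Fin)
open import Data.Bool using (Bool; true; false)
open import Data.Product using (Σ; _×_; _,_)
open import Data.List using (List; []; _∷_)
open import Data.List.Membership.Propositional using (_∈_)
open import Data.List.Relation.Unary.Any using (Any)
open import Data.Fin.Permutation using (Permutation′; _⟨$⟩ʳ_)
open import Relation.Binary.PropositionalEquality using (_≡_)
open import Relation.Nullary using (¬_)

record LTS (n k : ℕ) : Set where
  field
    init  : Fin n → Bool
    trans : Fin n → Fin k → Fin n → Bool

-- Assignment σ : V → {0,1}, with V = {x_{p,a,q}}; σ p a q = σ(x_{p,a,q}).
Assignment : ℕ → ℕ → Set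
Assignment n k = Fin n → Fin k → Fin n → Bool

-- A propositional formula over V, represented semantically by the set of
-- assignments satisfying it (V is finite, so every such set is definable).
Formula : ℕ → ℕ → Set₁
Formula n k = Assignment n k → Set

Generalizer : ℕ → ℕ → Set₁
Generalizer n k = Assignment n k → Formula n k

_≐_ : ∀ {n k} → Assignment n k → Assignment n k → Set
σ ≐ ρ = ∀ p a q → σ p a q ≡ ρ p a q

-- Events of an execution of GCG: a candidate that was a solution,
-- or a candidate that was not (and was generalized).
data Event (n k : ℕ) : Set where
  solE  : Assignment n k → Event n k
  failE : Assignment n k → Event n k

assignOf : ∀ {n k} → Event n k → Assignment n k
assignOf (solE σ)  = σ
assignOf (failE σ) = σ

-- History of an execution, most recent event first.
History : ℕ → ℕ → Set
History n k = List (Event n k)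

module Setting {n k : ℕ}
  (Q0  : Fin n → Bool)
  (Δ0  : Fin n → Fin k → Fin n → Bool)
  (Φ   : Formula n k)
  (Sat : LTS n k → Set)                     -- M ⊨ ψ
  where

  M : Assignment n k → LTS n k
  M σ = record { init = Q0 ; trans = σ }

  PhiExtendsΔ0 : Set
  PhiExtendsΔ0 = ∀ σ → Φ σ → ∀ p a q → Δ0 p a q ≡ true → σ p a q ≡ true

  InA : Fin n → Set
  InA q = (Q0 q ≡ false) × (∀ a p → Δ0 q a p ≡ false) × (∀ p a → Δ0 p a q ≡ false)

  _≃_ : Assignment n k → Assignment n k → Set
  σ ≃ ρ = Σ (Permutation′ n) λ f →
            (∀ q → ¬ InA q → f ⟨$⟩ʳ q ≡ q) ×
            (∀ p a q → σ p a q ≡ ρ (f ⟨$⟩ʳ p) a (f ⟨$⟩ʳ q))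

  Class : Assignment n k → Formula n k
  Class ρ σ = Φ σ × (σ ≃ ρ)

  SpecInvariant : Set
  SpecInvariant = ∀ σ ρ → Φ σ → Φ ρ → σ ≃ ρ → Sat (M σ) → Sat (M ρ)

  Proper : Generalizer n k → Set
  Proper γ = ∀ σ → Φ σ → ¬ Sat (M σ) →
               γ σ σ × (∀ ρ → Φ ρ → Sat (M ρ) → ¬ γ σ ρ)

  -- equivalence closure of γ:  ⋁_{σ ∈ [ρ]} γ(σ)
  closure : Generalizer n k → Generalizer n k
  closure γ ρ τ = Σ (Assignment n k) λ σ → Class ρ σ × γ σ τ

  module GCG (g : Generalizer n k) where

    prunedBy : Event n k → Formula n k
    prunedBy (solE σ)  = Class σ
    prunedBy (failE σ) = g σ

    Cur : History n k → Formula n k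
    Cur []      τ = Φ τ
    Cur (e ∷ h) τ = Cur h τ × ¬ prunedBy e τ

    data Exec : History n k → Set where
      start : Exec []
      solS  : ∀ {h σ} → Exec h → Cur h σ → Sat (M σ)   → Exec (solE σ ∷ h)
      failS : ∀ {h σ} → Exec h → Cur h σ → ¬ Sat (M σ) → Exec (failE σ ∷ h)

    Terminated : History n k → Set
    Terminated h = Exec h × ¬ (Σ (Assignment n k) λ σ → Cur h σ)

    InCand : History n k → Assignment n k → Set
    InCand h τ = Any (λ e → assignOf e ≡ τ) h

    InSol : History n k → Assignment n k → Set
    InSol h τ = solE τ ∈ h

    Pruned : History n k → Formula n k
    Pruned h τ = Any (λ e → prunedBy e τ) h

    Property1 : Set
    Property1 = ∀ h → Terminated h → ∀ σ → Φ σ →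
                  ∀ τ₁ τ₂ → Class σ τ₁ → InSol h τ₁ → Class σ τ₂ → InSol h τ₂ → τ₁ ≐ τ₂

    Property2 : Set
    Property2 = ∀ h → Terminated h → ∀ σ → Φ σ →
                  ∀ τ₁ τ₂ → Class σ τ₁ → InCand h τ₁ → Class σ τ₂ → InCand h τ₂ → τ₁ ≐ τ₂

    Property3 : Set
    Property3 = ∀ h → Exec h → ∀ σ → failE σ ∈ h →
                  ∀ ρ → Φ ρ → ρ ≃ σ → ∀ τ → g ρ τ → Pruned h τ

{-# OPTIONS --safe #-}
module Submission where

-- Every step of GCG removes the whole ≃-class of its candidate σ from Φ_cur: a
-- solution removes [σ] explicitly, and a non-solution removes the closure
-- γ̃(σ) = ⋁_{σ' ∈ [σ]} γ(σ'), which contains each σ' ∈ [σ] because σ' is again a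
-- non-solution (ψ is ≃-invariant) and γ is proper. Since Φ_cur only shrinks, later
-- candidates lie in other classes, so each class meets Cand, and hence Sol ⊆ Cand,
-- at most once. Property 3 holds because γ̃ is constant on ≃-classes.

open import Defs
open import Data.Nat using (ℕ)
open import Data.Fin using (Fin)
open import Data.Bool using (Bool)
open import Data.Product using (_×_; _,_; proj₁)
open import Data.Empty using (⊥-elim)
open import Data.List using ([]; _∷_)
open import Data.List.Relation.Unary.Any as Any using (here; there)
open import Data.List.Membership.Propositional using (lose)
open import Data.Fin.Permutation using (_⟨$⟩ʳ_; _⟨$⟩ˡ_; _∘ₚ_; flip; inverseʳ; inverseˡ)
open import Relation.Binary.PropositionalEquality
  using (_≡_; refl; sym; trans; cong; cong₂; module ≡-Reasoning)
open import Relation.Nullary using (¬_)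

module Isomorphism {n k : ℕ} (Q0 : Fin n → Bool) (Δ0 : Fin n → Fin k → Fin n → Bool)
    (Φ : Formula n k) (Sat : LTS n k → Set) where
  open Setting Q0 Δ0 Φ Sat

  ≃-trans : ∀ {σ ρ τ} → σ ≃ ρ → ρ ≃ τ → σ ≃ τ
  ≃-trans (f , f-fix , f-iso) (g , g-fix , g-iso) =
    f ∘ₚ g ,
    (λ q q∉A → trans (cong (g ⟨$⟩ʳ_) (f-fix q q∉A)) (g-fix q q∉A)) ,
    (λ p a q → trans (f-iso p a q) (g-iso (f ⟨$⟩ʳ p) a (f ⟨$⟩ʳ q)))

  ≃-sym : ∀ {σ ρ} → σ ≃ ρ → ρ ≃ σ
  ≃-sym {σ} {ρ} (f , f-fix , f-iso) = flip f , flip-fix , flip-iso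
    where
    flip-fix : ∀ q → ¬ InA q → f ⟨$⟩ˡ q ≡ q
    flip-fix q q∉A = trans (cong (f ⟨$⟩ˡ_) (sym (f-fix q q∉A))) (inverseˡ f)

    flip-iso : ∀ p a q → ρ p a q ≡ σ (f ⟨$⟩ˡ p) a (f ⟨$⟩ˡ q)
    flip-iso p a q = begin
      ρ p a q                                         ≡⟨ cong₂ (λ x y → ρ x a y) (sym (inverseʳ f)) (sym (inverseʳ f)) ⟩
      ρ (f ⟨$⟩ʳ (f ⟨$⟩ˡ p)) a (f ⟨$⟩ʳ (f ⟨$⟩ˡ q))   ≡⟨ sym (f-iso (f ⟨$⟩ˡ p) a (f ⟨$⟩ˡ q)) ⟩
      σ (f ⟨$⟩ˡ p) a (f ⟨$⟩ˡ q)                       ∎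
      where open ≡-Reasoning

  closure-resp-≃ : ∀ (γ : Generalizer n k) {ρ σ τ} → ρ ≃ σ → closure γ ρ τ → closure γ σ τ
  closure-resp-≃ γ {ρ} {σ} ρ≃σ (σ' , (Φσ' , σ'≃ρ) , γσ'τ) =
    σ' , (Φσ' , ≃-trans {σ'} {ρ} {σ} σ'≃ρ ρ≃σ) , γσ'τ

module Execution {n k : ℕ} (Q0 : Fin n → Bool) (Δ0 : Fin n → Fin k → Fin n → Bool)
    (Φ : Formula n k) (Sat : LTS n k → Set) (g : Generalizer n k) where
  open Setting Q0 Δ0 Φ Sat
  open GCG g

  Cur⇒Φ : ∀ h {τ} → Cur h τ → Φ τ
  Cur⇒Φ []      Φτ         = Φτ
  Cur⇒Φ (_ ∷ h) (Curτ , _) = Cur⇒Φ h Curτ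

  Exec-tail : ∀ {e h} → Exec (e ∷ h) → Exec h
  Exec-tail (solS ex _ _)  = ex
  Exec-tail (failS ex _ _) = ex

  Exec-head : ∀ {e h} → Exec (e ∷ h) → Cur h (assignOf e)
  Exec-head (solS _ Curσ _)  = Curσ
  Exec-head (failS _ Curσ _) = Curσ

  sol⇒cand : ∀ {h τ} → InSol h τ → InCand h τ
  sol⇒cand = Any.map (λ eq → cong assignOf (sym eq))

module ClosureExecution {n k : ℕ} (Q0 : Fin n → Bool) (Δ0 : Fin n → Fin k → Fin n → Bool)
    (Φ : Formula n k) (Sat : LTS n k → Set) (γ : Generalizer n k)
    (spec-invariant : Setting.SpecInvariant Q0 Δ0 Φ Sat)
    (proper : Setting.Proper Q0 Δ0 Φ Sat γ) where
  open Setting Q0 Δ0 Φ Sat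
  open GCG (closure γ)
  open Isomorphism Q0 Δ0 Φ Sat
  open Execution Q0 Δ0 Φ Sat (closure γ)

  -- For a non-solution σ, each τ ∈ [σ] is a non-solution, so τ ⊨ γ(τ) by properness
  -- and τ is among the disjuncts of γ̃(σ).
  step-prunes-class : ∀ {e h τ} → Exec (e ∷ h) → Φ τ → τ ≃ assignOf e → prunedBy e τ
  step-prunes-class (solS _ _ _) Φτ τ≃σ = Φτ , τ≃σ
  step-prunes-class {failE σ} {h} {τ} (failS _ Curσ σ⊭ψ) Φτ τ≃σ =
    τ , (Φτ , τ≃σ) , proj₁ (proper τ Φτ τ⊭ψ)
    where
    τ⊭ψ : ¬ Sat (M τ)
    τ⊭ψ τ⊨ψ = σ⊭ψ (spec-invariant τ σ Φτ (Cur⇒Φ h Curσ) τ≃σ τ⊨ψ)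

  Cur-≄-candidate : ∀ {h σ τ} → Exec h → InCand h σ → Cur h τ → ¬ τ ≃ σ
  Cur-≄-candidate {_ ∷ h} ex (here refl) (Curτ , τ∉) τ≃σ =
    τ∉ (step-prunes-class ex (Cur⇒Φ h Curτ) τ≃σ)
  Cur-≄-candidate ex (there σ∈h) (Curτ , _) =
    Cur-≄-candidate (Exec-tail ex) σ∈h Curτ

  candidate-unique : ∀ {h τ₁ τ₂} → Exec h → InCand h τ₁ → InCand h τ₂ → τ₁ ≃ τ₂ → τ₁ ≐ τ₂
  candidate-unique ex (here refl) (here refl) _ = λ _ _ _ → refl
  candidate-unique ex (here refl) (there τ₂∈h) τ₁≃τ₂ =
    ⊥-elim (Cur-≄-candidate (Exec-tail ex) τ₂∈h (Exec-head ex) τ₁≃τ₂)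
  candidate-unique ex (there τ₁∈h) (here refl) τ₁≃τ₂ =
    ⊥-elim (Cur-≄-candidate (Exec-tail ex) τ₁∈h (Exec-head ex) (≃-sym τ₁≃τ₂))
  candidate-unique ex (there τ₁∈h) (there τ₂∈h) =
    candidate-unique (Exec-tail ex) τ₁∈h τ₂∈h

  property2 : Property2
  property2 h (ex , _) σ _ τ₁ τ₂ (_ , τ₁≃σ) τ₁∈h (_ , τ₂≃σ) τ₂∈h =
    candidate-unique ex τ₁∈h τ₂∈h (≃-trans {τ₁} {σ} {τ₂} τ₁≃σ (≃-sym {τ₂} {σ} τ₂≃σ))

  property1 : Property1
  property1 h t σ Φσ τ₁ τ₂ τ₁∈[σ] τ₁∈h τ₂∈[σ] τ₂∈h =
    property2 h t σ Φσ τ₁ τ₂ τ₁∈[σ] (sol⇒cand τ₁∈h) τ₂∈[σ] (sol⇒cand τ₂∈h)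

  property3 : Property3
  property3 h _ σ σ∈h ρ _ ρ≃σ τ γ̃ρτ = lose σ∈h (closure-resp-≃ γ {ρ} {σ} ρ≃σ γ̃ρτ)

theorem5 : ∀ {n k : ℕ} (Q0 : Fin n → Bool) (Δ0 : Fin n → Fin k → Fin n → Bool)
             (Φ : Formula n k) (Sat : LTS n k → Set) (γ : Generalizer n k) →
             Setting.PhiExtendsΔ0 Q0 Δ0 Φ Sat →
             Setting.SpecInvariant Q0 Δ0 Φ Sat →
             Setting.Proper Q0 Δ0 Φ Sat γ →
             Setting.GCG.Property1 Q0 Δ0 Φ Sat (Setting.closure Q0 Δ0 Φ Sat γ) ×
             Setting.GCG.Property2 Q0 Δ0 Φ Sat (Setting.closure Q0 Δ0 Φ Sat γ) ×
             Setting.GCG.Property3 Q0 Δ0 Φ Sat (Setting.closure Q0 Δ0 Φ Sat γ)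
theorem5 Q0 Δ0 Φ Sat γ _ spec-invariant proper =
  property1 , property2 , property3
  where open ClosureExecution Q0 Δ0 Φ Sat γ spec-invariant proper
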